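{- Let $R(x_1,\dots,x_n)$ be a relation on $\mathbb{Z}$ definable by a first-order formula $\theta(x_1,\dots,x_n)$ in the structure $\langle \mathbb{Z},\{'\}\rangle$, and let $R^*$ be the relation defined by the same formula $\theta$ in $M_Z=\langle \mathbb{Z}\times S,\{'\}\rangle$. Then there exists a natural number $w$ such that $R^*(\overline a)\Leftrightarrow R^*(\overline b)$ for any two $w$-indistinguishable vectors $\overline a,\overline b\in(\mathbb{Z}\times S)^n$.
   Context: $'$ is the successor relation on $\mathbb{Z}$ ($y=x'$ iff $y=x+1$). $S$ is a countably infinite set and $M_Z$ has support $\mathbb{Z}\times S$ with $(x,y)=(x_1,y_1)'$ iff $x=x_1+1$ and $y=y_1$. For $a\in\mathbb{Z}\times S$ write $a=(a^1,a^2)$. Let $\mathbb{Z}_\infty=\mathbb{Z}\cup\{\infty\}$ with $z<\infty$ for all $z\in\mathbb{Z}$ and $|\infty|=\infty$. For $a,b\in\mathbb{Z}\times S$ define $a-b=a^1-b^1$ if $a^2=b^2$ and $a-b=\infty$ otherwise. For a natural number $m$, vectors $\overline a=(a_1,\dots,a_n)$, $\overline b=(b_1,\dots,b_n)$ are $m$-indistinguishable if for all $i,j\le n$, $|a_i-a_j|<m$ or $|b_i-b_j|<m$ implies $a_i-a_j=b_i-b_j$. -}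

module Defs where

open import Data.Nat using (ℕ; suc) renaming (_<_ to _<ℕ_)
open import Data.Integer using (ℤ; _+_; _-_; ∣_∣; 1ℤ)
open import Data.Fin using (Fin; zero; suc)
open import Data.Maybe using (Maybe; just; nothing)
open import Data.Product using (_×_; _,_; proj₁; proj₂; Σ)
open import Data.Sum using (_⊎_)
open import Data.Empty using (⊥)
open import Relation.Nullary using (¬_; yes; no)
open import Relation.Binary.PropositionalEquality using (_≡_; cong; trans; sym)
open import Relation.Binary.Definitions using (DecidableEquality)
open import Function.Bundles using (_↔_; Inverse)
import Data.Nat as N

-- Formula n has free variables
-- among x_0 … x_{n-1} (Fin n); quantifiers bind a new variable 'zero'.

data Formula : ℕ → Set where
  _≐_  : ∀ {n} → Fin n → Fin n → Formula n
  Succ : ∀ {n} → Fin n → Fin n → Formula n      -- x_j = x_i'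
  ⊤f ⊥f : ∀ {n} → Formula n
  ¬f_  : ∀ {n} → Formula n → Formula n
  _∧f_ _∨f_ _⇒f_ : ∀ {n} → Formula n → Formula n → Formula n
  ∃f ∀f : ∀ {n} → Formula (suc n) → Formula n

-- A structure for the signature {'}: a carrier with a binary relation
-- S' x y meaning "y = x'".
record Structure : Set₁ where
  field
    Carrier : Set
    _′≡_    : Carrier → Carrier → Set

open Structure public

extend : ∀ {A : Set} {n} → (Fin n → A) → A → Fin (suc n) → A
extend ρ c zero    = c
extend ρ c (suc i) = ρ i

record ⊤′ : Set where

Sat : (M : Structure) → ∀ {n} → Formula n → (Fin n → Carrier M) → Set
Sat M (i ≐ j)    ρ = ρ i ≡ ρ j
Sat M (Succ i j) ρ = _′≡_ M (ρ i) (ρ j)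
Sat M ⊤f         ρ = ⊤′
Sat M ⊥f         ρ = ⊥
Sat M (¬f φ)     ρ = ¬ Sat M φ ρ
Sat M (φ ∧f ψ)   ρ = Sat M φ ρ × Sat M ψ ρ
Sat M (φ ∨f ψ)   ρ = Sat M φ ρ ⊎ Sat M ψ ρ
Sat M (φ ⇒f ψ)   ρ = Sat M φ ρ → Sat M ψ ρ
Sat M (∃f φ)     ρ = Σ (Carrier M) λ c → Sat M φ (extend ρ c)
Sat M (∀f φ)     ρ = (c : Carrier M) → Sat M φ (extend ρ c)

ℤ-struct : Structure
ℤ-struct = record { Carrier = ℤ ; _′≡_ = λ x y → y ≡ x + 1ℤ }

MZ : Set → Structure
MZ S = record { Carrier = ℤ × S
              ; _′≡_ = λ a b → (proj₁ b ≡ proj₁ a + 1ℤ) × (proj₂ b ≡ proj₂ a) }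

-- ℤ∞ = ℤ ∪ {∞}, represented as Maybe ℤ (nothing = ∞).

ℤ∞ : Set
ℤ∞ = Maybe ℤ

decEqFromℕ : {S : Set} → S ↔ ℕ → DecidableEquality S
decEqFromℕ iso s t with Inverse.to iso s N.≟ Inverse.to iso t
... | yes p = yes (trans (sym (Inverse.strictlyInverseʳ iso s))
                   (trans (cong (Inverse.from iso) p) (Inverse.strictlyInverseʳ iso t)))
... | no ¬p = no λ q → ¬p (cong (Inverse.to iso) q)

diff : {S : Set} → DecidableEquality S → ℤ × S → ℤ × S → ℤ∞
diff _≟S_ (a1 , a2) (b1 , b2) with a2 ≟S b2
... | yes _ = just (a1 - b1)
... | no  _ = nothing

-- |z| < m  (|∞| = ∞ is never < m)
absLt : ℤ∞ → ℕ → Set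
absLt nothing  m = ⊥
absLt (just z) m = ∣ z ∣ <ℕ m

Indist : {S : Set} → DecidableEquality S → ℕ → ∀ {n} →
         (Fin n → ℤ × S) → (Fin n → ℤ × S) → Set
Indist dec m {n} a b = ∀ (i j : Fin n) →
  (absLt (diff dec (a i) (a j)) m ⊎ absLt (diff dec (b i) (b j)) m) →
  diff dec (a i) (a j) ≡ diff dec (b i) (b j)

module Submission where

-- Proof idea: an Ehrenfeucht–Fraïssé (back-and-forth) argument.
--
-- Every formula θ gets a radius: atomic formulas have radius 2, the
-- propositional connectives take the maximum radius of their parts, and a
-- quantifier doubles the radius of its body.  By induction on θ, satisfaction
-- of θ in M_Z transfers between any two radius(θ)-indistinguishable
-- assignments, so w = radius(θ) witnesses the theorem.
--
-- Atomic formulas state that a difference equals 0 or 1, and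
-- 2-indistinguishability pins down such differences.  The quantifier step is
-- the extension lemma: if ā and b̄ are 2W-indistinguishable, every point c has
-- a partner d making (c,ā) and (d,b̄) W-indistinguishable.  If c lies within
-- distance W of some aᵢ, then d is bᵢ translated by the same offset; the
-- differences of c to the other points are then those of aᵢ shifted by that
-- offset, and the triangle inequality keeps them inside radius 2W.  Otherwise
-- d is placed on a copy of ℤ not used by b̄, which exists because S is
-- infinite.

open import Defs
open import Data.Nat using (ℕ)
open import Data.Product using (∃-syntax)
open import Function.Bundles using (_↔_; _⇔_)

open import Data.Nat as ℕ using (zero; suc; z≤n; s≤s; _⊔_) renaming (_<_ to _<ℕ_; _≤_ to _≤ℕ_)
import Data.Nat.Properties as ℕP
open import Data.Integer using (ℤ; _+_; _-_; -_; ∣_∣; 0ℤ; 1ℤ)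
import Data.Integer.Properties as ℤP
open import Data.Integer.Tactic.RingSolver using (solve-∀)
open import Data.Fin using (Fin; zero; suc)
open import Data.Fin.Properties using (any?)
open import Data.Maybe using (just; nothing)
import Data.Maybe as Maybe
open import Data.Maybe.Properties using (just-injective)
open import Data.Product using (_×_; _,_; proj₁; proj₂; ∃)
open import Data.Product.Properties using (×-≡,≡→≡; ×-≡,≡←≡)
import Data.Sum as Sum
open import Data.Sum using (_⊎_; inj₁; inj₂)
open import Data.Empty using (⊥-elim)
open import Relation.Nullary using (¬_; yes; no; Dec)
open import Relation.Binary.PropositionalEquality
open import Relation.Binary.Definitions using (DecidableEquality)
open import Function.Bundles using (Inverse; Equivalence; mk⇔)
open import Function using (_∘_)

open Equivalence using (to; from)

-- Finitely many natural numbers are all below some bound; this is what makes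
-- a countably infinite set inexhaustible by finitely many points.
strict-upper-bound : ∀ {n} (f : Fin n → ℕ) → ∃ λ m → ∀ i → f i <ℕ m
strict-upper-bound {zero}  f = 0 , λ ()
strict-upper-bound {suc n} f = suc (f zero) ⊔ m , bound
  where
    m = proj₁ (strict-upper-bound (f ∘ suc))
    bound : ∀ i → f i <ℕ suc (f zero) ⊔ m
    bound zero    = ℕP.m≤m⊔n (suc (f zero)) m
    bound (suc i) = ℕP.<-≤-trans (proj₂ (strict-upper-bound (f ∘ suc)) i) (ℕP.m≤n⊔m (suc (f zero)) m)

fresh-from-ℕ : {S : Set} → S ↔ ℕ → ∀ {n} (b : Fin n → S) → ∃ λ s → ∀ i → ¬ s ≡ b i
fresh-from-ℕ iso b = Inverse.from iso m , avoids
  where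
    m = proj₁ (strict-upper-bound (Inverse.to iso ∘ b))
    avoids : ∀ i → ¬ Inverse.from iso m ≡ b i
    avoids i s≡bᵢ = ℕP.<-irrefl code≡m (proj₂ (strict-upper-bound (Inverse.to iso ∘ b)) i)
      where
        code≡m : Inverse.to iso (b i) ≡ m
        code≡m = trans (cong (Inverse.to iso) (sym s≡bᵢ)) (Inverse.strictlyInverseˡ iso m)

add-cancel : ∀ z k → z ≡ (z + k) + - k
add-cancel = solve-∀

sub-cancel : ∀ x y → x ≡ y + (x - y)
sub-cancel = solve-∀

add-sub-cancel : ∀ y k → (y + k) - y ≡ k
add-sub-cancel = solve-∀

sub-antisym : ∀ x y → y - x ≡ - (x - y)
sub-antisym = solve-∀

add-sub-comm : ∀ x y k → (x + k) - y ≡ (x - y) + k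
add-sub-comm = solve-∀

absLt? : ∀ z m → Dec (absLt z m)
absLt? nothing  m = no λ ()
absLt? (just k) m = ∣ k ∣ ℕ.<? m

absLt-mono : ∀ z {m m′} → m ≤ℕ m′ → absLt z m → absLt z m′
absLt-mono (just k) m≤m′ h = ℕP.<-≤-trans h m≤m′

absLt-neg : ∀ z m → absLt (Maybe.map (-_) z) m → absLt z m
absLt-neg (just k) m h = subst (_<ℕ m) (ℤP.∣-i∣≡∣i∣ k) h

absLt-unshift : ∀ {k W} z → ∣ k ∣ <ℕ W → absLt (Maybe.map (_+ k) z) W → absLt z (W ℕ.+ W)
absLt-unshift {k} {W} (just z) |k|<W |z+k|<W = begin-strict
  ∣ z ∣                 ≡⟨ cong ∣_∣ (add-cancel z k) ⟩
  ∣ (z + k) + - k ∣     ≤⟨ ℤP.∣i+j∣≤∣i∣+∣j∣ (z + k) (- k) ⟩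
  ∣ z + k ∣ ℕ.+ ∣ - k ∣ ≡⟨ cong (∣ z + k ∣ ℕ.+_) (ℤP.∣-i∣≡∣i∣ k) ⟩
  ∣ z + k ∣ ℕ.+ ∣ k ∣   <⟨ ℕP.+-mono-< |z+k|<W |k|<W ⟩
  W ℕ.+ W               ∎
  where open ℕP.≤-Reasoning

module Transfer (S : Set) (_≟S_ : DecidableEquality S)
  (fresh : ∀ {n} (b : Fin n → S) → ∃ λ s → ∀ i → ¬ s ≡ b i) where

  P : Set
  P = ℤ × S

  D : P → P → ℤ∞
  D = diff _≟S_

  Ind : ℕ → ∀ {n} → (Fin n → P) → (Fin n → P) → Set
  Ind = Indist _≟S_

  shift : ℤ → P → P
  shift k (x , s) = (x + k , s)

  diff≡just⇔ : ∀ x y k → (D x y ≡ just k) ⇔ (x ≡ shift k y)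
  diff≡just⇔ (x , s) (y , t) k with s ≟S t
  ... | yes refl = mk⇔ (λ e → ×-≡,≡→≡ (offset (just-injective e) , refl))
                       (λ e → cong just (unoffset (proj₁ (×-≡,≡←≡ e))))
    where
      offset : x - y ≡ k → x ≡ y + k
      offset refl = sub-cancel x y
      unoffset : x ≡ y + k → x - y ≡ k
      unoffset refl = add-sub-cancel y k
  ... | no s≢t = mk⇔ (λ ()) (λ e → ⊥-elim (s≢t (proj₂ (×-≡,≡←≡ e))))

  shift-zero : ∀ x → shift 0ℤ x ≡ x
  shift-zero (x , s) = cong (_, s) (ℤP.+-identityʳ x)

  ≡⇔diff-zero : ∀ x y → (x ≡ y) ⇔ (D x y ≡ just 0ℤ)
  ≡⇔diff-zero x y = mk⇔ (λ x≡y → from (diff≡just⇔ x y 0ℤ) (trans x≡y (sym (shift-zero y))))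
                        (λ d≡0 → trans (to (diff≡just⇔ x y 0ℤ) d≡0) (shift-zero y))

  diff-self : ∀ x → D x x ≡ just 0ℤ
  diff-self x = to (≡⇔diff-zero x x) refl

  diff-apart : ∀ x y → ¬ proj₂ x ≡ proj₂ y → D x y ≡ nothing
  diff-apart (x , s) (y , t) s≢t with s ≟S t
  ... | yes s≡t = ⊥-elim (s≢t s≡t)
  ... | no _    = refl

  diff-swap : ∀ x y → D y x ≡ Maybe.map (-_) (D x y)
  diff-swap (x , s) (y , t) with s ≟S t | t ≟S s
  ... | yes _   | yes _   = cong just (sub-antisym x y)
  ... | yes s≡t | no t≢s  = ⊥-elim (t≢s (sym s≡t))
  ... | no s≢t  | yes t≡s = ⊥-elim (s≢t (sym t≡s))
  ... | no _    | no _    = refl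

  diff-shift : ∀ k x y → D (shift k x) y ≡ Maybe.map (_+ k) (D x y)
  diff-shift k (x , s) (y , t) with s ≟S t
  ... | yes _ = cong just (add-sub-comm x y k)
  ... | no _  = refl

  Alike : ℕ → P → P → P → P → Set
  Alike W x u y v = absLt (D x u) W ⊎ absLt (D y v) W → D x u ≡ D y v

  Ind-sym : ∀ {W n} {a b : Fin n → P} → Ind W a b → Ind W b a
  Ind-sym H i j near = sym (H i j (Sum.swap near))

  Ind-mono : ∀ {W W′ n} {a b : Fin n → P} → W′ ≤ℕ W → Ind W a b → Ind W′ a b
  Ind-mono {a = a} {b} le H i j = H i j ∘ Sum.map (absLt-mono (D (a i) (a j)) le)
                                                  (absLt-mono (D (b i) (b j)) le)

  Ind-⊔ˡ : ∀ {W W′ n} {a b : Fin n → P} → Ind (W ⊔ W′) a b → Ind W a b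
  Ind-⊔ˡ {W} {W′} = Ind-mono (ℕP.m≤m⊔n W W′)

  Ind-⊔ʳ : ∀ {W W′ n} {a b : Fin n → P} → Ind (W ⊔ W′) a b → Ind W′ a b
  Ind-⊔ʳ {W} {W′} = Ind-mono (ℕP.m≤n⊔m W W′)

  Ind-half : ∀ {W n} {a b : Fin n → P} → Ind (W ℕ.+ W) a b → Ind W a b
  Ind-half {W} = Ind-mono (ℕP.m≤n+m W W)

  pinned : ∀ {W n} {a b : Fin n → P} {k} i j → Ind W a b → ∣ k ∣ <ℕ W →
           D (a i) (a j) ≡ just k → D (b i) (b j) ≡ just k
  pinned i j H |k|<W eq = trans (sym (H i j (inj₁ (subst (λ z → absLt z _) (sym eq) |k|<W)))) eq

  -- Adding one point on each side preserves W-indistinguishability as soon as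
  -- the new points relate alike to the old ones; the reverse differences
  -- follow by antisymmetry of the difference.
  Ind-extend : ∀ {W n} {a b : Fin n → P} {c d} → Ind W a b →
               (∀ j → Alike W c (a j) d (b j)) → Ind W (extend a c) (extend b d)
  Ind-extend {c = c} {d} H new zero    zero    _    = trans (diff-self c) (sym (diff-self d))
  Ind-extend             H new zero    (suc j) near = new j near
  Ind-extend {W} {a = a} {b} {c} {d} H new (suc j) zero near = begin
    D (a j) c                    ≡⟨ diff-swap c (a j) ⟩
    Maybe.map (-_) (D c (a j))   ≡⟨ cong (Maybe.map (-_)) (new j near′) ⟩
    Maybe.map (-_) (D d (b j))   ≡⟨ diff-swap d (b j) ⟨
    D (b j) d                    ∎
    where
      open ≡-Reasoning
      unswap : ∀ x y → absLt (D y x) W → absLt (D x y) W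
      unswap x y = absLt-neg (D x y) W ∘ subst (λ z → absLt z W) (diff-swap x y)
      near′ : absLt (D c (a j)) W ⊎ absLt (D d (b j)) W
      near′ = Sum.map (unswap c (a j)) (unswap d (b j)) near
  Ind-extend H new (suc i) (suc j) near = H i j near

  -- Near partners: translate corresponding points by the same small offset k.
  -- Differences to the old points move by k, so radius W after the move needs
  -- only radius 2W before it.
  Ind-translate : ∀ {W n} {a b : Fin n → P} {k} i → ∣ k ∣ <ℕ W → Ind (W ℕ.+ W) a b →
                  Ind W (extend a (shift k (a i))) (extend b (shift k (b i)))
  Ind-translate {W} {a = a} {b} {k} i |k|<W H = Ind-extend (Ind-half H) new
    where
      unshift : ∀ x y → absLt (D (shift k x) y) W → absLt (D x y) (W ℕ.+ W)
      unshift x y = absLt-unshift (D x y) |k|<W ∘ subst (λ z → absLt z W) (diff-shift k x y)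
      new : ∀ j → Alike W (shift k (a i)) (a j) (shift k (b i)) (b j)
      new j near = begin
        D (shift k (a i)) (a j)          ≡⟨ diff-shift k (a i) (a j) ⟩
        Maybe.map (_+ k) (D (a i) (a j)) ≡⟨ cong (Maybe.map (_+ k)) (H i j near₂) ⟩
        Maybe.map (_+ k) (D (b i) (b j)) ≡⟨ diff-shift k (b i) (b j) ⟨
        D (shift k (b i)) (b j)          ∎
        where
          open ≡-Reasoning
          near₂ = Sum.map (unshift (a i) (a j)) (unshift (b i) (b j)) near

  Ind-far : ∀ {W n} {a b : Fin n → P} {c s} → Ind W a b →
            (∀ j → ¬ absLt (D c (a j)) W) → (∀ j → ¬ s ≡ proj₂ (b j)) →
            Ind W (extend a c) (extend b (0ℤ , s))
  Ind-far {W} {a = a} {b} {c} {s} H far new-sort = Ind-extend H new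
    where
      new : ∀ j → Alike W c (a j) (0ℤ , s) (b j)
      new j (inj₁ near) = ⊥-elim (far j near)
      new j (inj₂ near) =
        ⊥-elim (subst (λ z → absLt z W) (diff-apart (0ℤ , s) (b j) (new-sort j)) near)

  extension : ∀ {W n} {a b : Fin n → P} → Ind (W ℕ.+ W) a b →
              ∀ c → ∃ λ d → Ind W (extend a c) (extend b d)
  extension {W} {a = a} {b} H c with any? (λ i → absLt? (D c (a i)) W)
  ... | no far = (0ℤ , proj₁ new) , Ind-far (Ind-half H) (λ j near → far (j , near)) (proj₂ new)
    where new = fresh (proj₂ ∘ b)
  ... | yes (i , near) with D c (a i) in c-aᵢ | near
  ...   | just k | |k|<W =
    shift k (b i) , subst (λ c′ → Ind W (extend a c′) _) (sym c≡shift) (Ind-translate i |k|<W H)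
    where c≡shift = to (diff≡just⇔ c (a i) k) c-aᵢ

  radius : ∀ {n} → Formula n → ℕ
  radius (i ≐ j)    = 2
  radius (Succ i j) = 2
  radius ⊤f         = 0
  radius ⊥f         = 0
  radius (¬f φ)     = radius φ
  radius (φ ∧f ψ)   = radius φ ⊔ radius ψ
  radius (φ ∨f ψ)   = radius φ ⊔ radius ψ
  radius (φ ⇒f ψ)   = radius φ ⊔ radius ψ
  radius (∃f φ)     = radius φ ℕ.+ radius φ
  radius (∀f φ)     = radius φ ℕ.+ radius φ

  succ⇔diff-one : ∀ x y → _′≡_ (MZ S) x y ⇔ (D y x ≡ just 1ℤ)
  succ⇔diff-one x y = mk⇔ (from (diff≡just⇔ y x 1ℤ) ∘ ×-≡,≡→≡)
                          (×-≡,≡←≡ ∘ to (diff≡just⇔ y x 1ℤ))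

  -- The transfer theorem, one direction; the other follows by symmetry of Ind.
  transfer : ∀ {n} (θ : Formula n) {a b : Fin n → P} → Ind (radius θ) a b →
             Sat (MZ S) θ a → Sat (MZ S) θ b
  transfer (i ≐ j) {a} {b} H aᵢ≡aⱼ =
    from (≡⇔diff-zero (b i) (b j)) (pinned i j H (s≤s z≤n) (to (≡⇔diff-zero (a i) (a j)) aᵢ≡aⱼ))
  transfer (Succ i j) {a} {b} H s = from (succ⇔diff-one (b i) (b j))
    (pinned j i H (s≤s (s≤s z≤n)) (to (succ⇔diff-one (a i) (a j)) s))
  transfer ⊤f       H s = s
  transfer ⊥f       H s = s
  transfer (¬f φ)   H s = s ∘ transfer φ (Ind-sym H)
  transfer (φ ∧f ψ) H (s , t) = transfer φ (Ind-⊔ˡ H) s , transfer ψ (Ind-⊔ʳ H) t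
  transfer (φ ∨f ψ) H = Sum.map (transfer φ (Ind-⊔ˡ H)) (transfer ψ (Ind-⊔ʳ H))
  transfer (φ ⇒f ψ) H f = transfer ψ (Ind-⊔ʳ H) ∘ f ∘ transfer φ (Ind-sym (Ind-⊔ˡ H))
  transfer (∃f φ) H (c , s) = let (d , H′) = extension H c in d , transfer φ H′ s
  transfer (∀f φ) H f d = let (c , H′) = extension (Ind-sym H) d in transfer φ (Ind-sym H′) (f c)

lemma6 : (S : Set) (countable : S ↔ ℕ) (n : ℕ) (θ : Formula n) →
    ∃[ w ] (∀ a b → Indist (decEqFromℕ countable) w {n} a b →
    Sat (MZ S) θ a ⇔ Sat (MZ S) θ b)
lemma6 S countable n θ = radius θ , λ a b H → mk⇔ (transfer θ H) (transfer θ (Ind-sym H))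
  where open Transfer S (decEqFromℕ countable) (fresh-from-ℕ countable)
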